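{- For each positive integer $n$, write the $M$-expansion of $n$ as $n=\varepsilon_1M_1+\cdots+\varepsilon_\ell M_\ell$. Then the $\mu$-expansion of $s_n$ has remainder $0$ and is exactly $s_n=\varepsilon_1\mu_1+\cdots+\varepsilon_\ell\mu_\ell$; that is, the list of $\mu$-digits of $s_n$ equals the list $(\varepsilon_1,\dots,\varepsilon_\ell)$ of $M$-digits of $n$.
   Context: Sequence $s_n$: let $A_1=(5)$ and for $k\ge2$ let $A_k$ be the concatenation $A_{k-1},A_{k-1},(1)$; $A$ is the limiting infinite list; $a_0=0$, $a_n$ is the $n$th entry of $A$ for $n\ge1$, and $s_n=a_0+\cdots+a_n$. For $i\ge1$ let $M_i=2^i-1$ and $\mu_i=3M_i+2$. $M$-expansion of a positive integer $n$: let $\ell=\max\{i:n\ge M_i\}$ and write $n=M_\ell+r$ with $0\le r\le M_\ell$; if $r=0$ stop with $n=M_\ell$; if $r=M_\ell$ stop with $n=2M_\ell$; otherwise continue with $r$. This gives $n=\varepsilon_1M_1+\cdots+\varepsilon_\ell M_\ell$, $\varepsilon_i\in\{0,1,2\}$, $\varepsilon_\ell\neq0$; the list $(\varepsilon_1,\dots,\varepsilon_\ell)$ is the list of $M$-digits of $n$. $\mu$-expansion of a positive integer $n$: if $n\le4$ stop (remainder $n$). Otherwise let $\ell=\max\{i:n\ge\mu_i\}$ and write $n=\mu_\ell+r'$ with $0\le r'\le\mu_\ell$; if $r'=0$ stop with $n=\mu_\ell$; if $r'=\mu_\ell$ stop with $n=2\mu_\ell$; otherwise continue with $r'$. This gives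 $n=r+\varepsilon_1\mu_1+\cdots+\varepsilon_\ell\mu_\ell$, $r\in\{0,\dots,4\}$, $\varepsilon_i\in\{0,1,2\}$; when $r=0$ the list $(\varepsilon_1,\dots,\varepsilon_\ell)$ is the list of $\mu$-digits of $n$. -}

module Defs where

open import Data.Nat using (ℕ; zero; suc; _+_; _*_; _∸_; _^_; _≤ᵇ_; _≡ᵇ_)
open import Data.Bool using (Bool; true; false; if_then_else_)
open import Data.List using (List; []; _∷_; _++_; [_]; length; filter; map; upTo; sum)
open import Data.Product using (_×_; _,_; proj₁; proj₂)
open import Relation.Nullary.Decidable using (⌊_⌋)
import Data.Nat as N

-- A k  represents  A_{k+1}  (so A 0 = A_1 = (5)).
Alist : ℕ → List ℕ
Alist zero    = 5 ∷ []
Alist (suc k) = Alist k ++ Alist k ++ (1 ∷ [])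

-- 1-indexed lookup, default 0 outside the list
nth : List ℕ → ℕ → ℕ
nth []       _             = 0
nth (x ∷ xs) zero          = 0
nth (x ∷ xs) (suc zero)    = x
nth (x ∷ xs) (suc (suc n)) = nth xs (suc n)

-- a_0 = 0, a_n = n-th entry of the limiting list A.  A_{n+1} (= Alist n)
-- has length 2^{n+1}-1 ≥ n and every A_k is a prefix of A_{k+1}, so the
-- n-th entry of A is the n-th entry of A_{n+1}.
a : ℕ → ℕ
a zero    = 0
a (suc n) = nth (Alist (suc n)) (suc n)

s : ℕ → ℕ
s zero    = a zero
s (suc n) = s n + a (suc n)

M : ℕ → ℕ
M i = 2 ^ i ∸ 1

μ : ℕ → ℕ
μ i = 3 * M i + 2

-- level f n = max { i ≥ 1 : f i ≤ n }, for strictly increasing f with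
-- f 1 ≤ n (search upward from i, with fuel; f i ≥ i so fuel n suffices).
levelFrom : (ℕ → ℕ) → ℕ → ℕ → ℕ → ℕ
levelFrom f n i zero       = i
levelFrom f n i (suc fuel) =
  if f (suc i) ≤ᵇ n then levelFrom f n (suc i) fuel else i

level : (ℕ → ℕ) → ℕ → ℕ
level f n = levelFrom f n 1 n

-- M-expansion: returns the list of indices ℓ used at each step
-- (an index appears twice in the case r = M_ℓ).
Msteps : ℕ → ℕ → List ℕ
Msteps zero       n = []
Msteps (suc fuel) zero = []
Msteps (suc fuel) (suc m) =
  let n = suc m
      ℓ = level M n
      r = n ∸ M ℓ
  in if r ≡ᵇ 0 then ℓ ∷ []
     else if r ≡ᵇ M ℓ then ℓ ∷ ℓ ∷ []
     else ℓ ∷ Msteps fuel r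

μsteps : ℕ → ℕ → List ℕ × ℕ
μsteps zero       n = [] , n
μsteps (suc fuel) n =
  if n ≤ᵇ 4 then ([] , n)
  else
    (let ℓ = level μ n
         r = n ∸ μ ℓ
     in if r ≡ᵇ 0 then (ℓ ∷ [] , 0)
        else if r ≡ᵇ μ ℓ then (ℓ ∷ ℓ ∷ [] , 0)
        else (ℓ ∷ proj₁ (μsteps fuel r) , proj₂ (μsteps fuel r)))

-- From index lists to digit lists (ε_1, …, ε_ℓ), ℓ = the first
-- (largest) index used, ε_i = number of times index i was used.
count : ℕ → List ℕ → ℕ
count i xs = length (filter (λ j → i N.≟ j) xs)

top : List ℕ → ℕ
top []      = 0
top (x ∷ _) = x

digits : List ℕ → List ℕ
digits is = map (λ j → count (suc j) is) (upTo (top is))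

-- list of M-digits of n (n ≥ 1); the expansion takes at most n steps
Mdigits : ℕ → List ℕ
Mdigits n = digits (Msteps n n)

μremainder : ℕ → ℕ
μremainder n = proj₂ (μsteps n n)

μdigits : ℕ → List ℕ
μdigits n = digits (proj₁ (μsteps n n))

-- A_{k+1} = A_k A_k (1) has length M_{k+1} and sum μ_{k+1}, and it is a prefix of A, so
-- s_{M_ℓ + r} = μ_ℓ + s_r whenever r ≤ M_ℓ.  Since s is strictly increasing, the step
-- n = M_ℓ + r of the M-expansion of n becomes the step s_n = μ_ℓ + s_r of the μ-expansion
-- of s_n: the levels agree, r = 0 iff s_r = 0, and r = M_ℓ iff s_r = μ_ℓ.
module Submission where

open import Defs
open import Data.Nat
  using (ℕ; zero; suc; _+_; _*_; _∸_; _^_; _≤_; _<_; z≤n; s≤s; _≤ᵇ_; _≡ᵇ_)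
open import Data.Nat.Properties
open import Data.Nat.Tactic.RingSolver using (solve-∀)
open import Data.Nat.ListAction using (sum)
open import Data.Nat.ListAction.Properties using (sum-++)
open import Data.List using (List; []; _∷_; [_]; _++_; length; take)
open import Data.List.Properties using (length-++; ++-identityʳ; ++-assoc)
open import Data.List.Relation.Unary.All using (All; []; _∷_)
open import Data.List.Relation.Unary.All.Properties using (++⁺)
open import Data.Product using (_×_; ∃-syntax; _,_; proj₁; proj₂)
open import Data.Bool using (Bool; true; false; T; if_then_else_)
open import Data.Sum using (inj₁; inj₂)
open import Function using (_∘_)
open import Function.Definitions using (Injective)
open import Relation.Binary.Definitions using (tri<; tri≈; tri>)
open import Relation.Nullary.Negation using (contradiction)
open import Relation.Nullary.Reflects using (ofⁿ; fromEquivalence; det)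
open import Relation.Binary.PropositionalEquality
  using (_≡_; refl; sym; trans; cong; cong₂; subst; module ≡-Reasoning)

StrictlyIncreasing : (ℕ → ℕ) → Set
StrictlyIncreasing f = ∀ i → f i < f (suc i)

module _ {f : ℕ → ℕ} (inc : StrictlyIncreasing f) where

  increasing⇒monotone : ∀ {i j} → i ≤ j → f i ≤ f j
  increasing⇒monotone {j = zero}  z≤n = ≤-refl
  increasing⇒monotone {j = suc j} i≤1+j with m≤n⇒m<n∨m≡n i≤1+j
  ... | inj₁ (s≤s i≤j) = ≤-trans (increasing⇒monotone i≤j) (<⇒≤ (inc j))
  ... | inj₂ refl      = ≤-refl

  increasing⇒strictMono : ∀ {i j} → i < j → f i < f j
  increasing⇒strictMono {i} i<j = <-≤-trans (inc i) (increasing⇒monotone i<j)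

  increasing⇒injective : Injective _≡_ _≡_ f
  increasing⇒injective {i} {j} fi≡fj with <-cmp i j
  ... | tri< i<j _ _ = contradiction fi≡fj (<⇒≢ (increasing⇒strictMono i<j))
  ... | tri≈ _ i≡j _ = i≡j
  ... | tri> _ _ j<i = contradiction (sym fi≡fj) (<⇒≢ (increasing⇒strictMono j<i))

  increasing⇒id≤ : ∀ i → i ≤ f i
  increasing⇒id≤ zero    = z≤n
  increasing⇒id≤ (suc i) = <-≤-trans (s≤s (increasing⇒id≤ i)) (inc i)

  levelFrom-unique : ∀ n i fuel ℓ → i ≤ ℓ → ℓ ≤ i + fuel → f ℓ ≤ n → n < f (suc ℓ) →
                     levelFrom f n i fuel ≡ ℓ
  levelFrom-unique n i zero ℓ i≤ℓ ℓ≤i _ _ = ≤-antisym i≤ℓ (subst (ℓ ≤_) (+-identityʳ i) ℓ≤i)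
  levelFrom-unique n i (suc fuel) ℓ i≤ℓ ℓ≤i+fuel fℓ≤n n<fℓ+1
    with f (suc i) ≤ᵇ n in test | m≤n⇒m<n∨m≡n i≤ℓ
  ... | true  | inj₁ i<ℓ = levelFrom-unique n (suc i) fuel ℓ i<ℓ
                                  (subst (ℓ ≤_) (+-suc i fuel) ℓ≤i+fuel) fℓ≤n n<fℓ+1
  ... | true  | inj₂ refl = contradiction (≤ᵇ⇒≤ _ n (subst T (sym test) _)) (<⇒≱ n<fℓ+1)
  ... | false | inj₁ i<ℓ =
    contradiction (≤⇒≤ᵇ (≤-trans (increasing⇒monotone i<ℓ) fℓ≤n)) (subst T test)
  ... | false | inj₂ i≡ℓ = i≡ℓ

  level-unique : ∀ n ℓ → 1 ≤ ℓ → f ℓ ≤ n → n < f (suc ℓ) → level f n ≡ ℓ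
  level-unique n ℓ 1≤ℓ fℓ≤n n<fℓ+1 =
    levelFrom-unique n 1 n ℓ 1≤ℓ (m≤n⇒m≤1+n (≤-trans (increasing⇒id≤ ℓ) fℓ≤n)) fℓ≤n n<fℓ+1

≡ᵇ-injective : {f : ℕ → ℕ} → Injective _≡_ _≡_ f → ∀ x y → (f x ≡ᵇ f y) ≡ (x ≡ᵇ y)
≡ᵇ-injective {f} inj x y =
  det (fromEquivalence (inj ∘ ≡ᵇ⇒≡ (f x) (f y)) (≡⇒≡ᵇ (f x) (f y) ∘ cong f))
      (fromEquivalence (≡ᵇ⇒≡ x y) (≡⇒≡ᵇ x y))

Doubling : (ℕ → ℕ) → Set
Doubling f = ∀ i → f (suc i) ≡ f i + f i + 1

doubling⇒increasing : ∀ {f} → Doubling f → StrictlyIncreasing f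
doubling⇒increasing {f} double i rewrite double i =
  ≤-<-trans (m≤m+n (f i) (f i)) (m<m+n (f i + f i) (s≤s z≤n))

M-doubling : Doubling M
M-doubling i with 2 ^ i | m^n>0 2 i
... | suc q | _ = double-pred q
  where
  double-pred : ∀ q → q + suc (q + 0) ≡ q + q + 1
  double-pred = solve-∀

μ-doubling : Doubling μ
μ-doubling i rewrite M-doubling i = triple-plus-two (M i)
  where
  triple-plus-two : ∀ m → 3 * (m + m + 1) + 2 ≡ (3 * m + 2) + (3 * m + 2) + 1
  triple-plus-two = solve-∀

M-increasing : StrictlyIncreasing M
M-increasing = doubling⇒increasing {M} M-doubling

μ-increasing : StrictlyIncreasing μ
μ-increasing = doubling⇒increasing {μ} μ-doubling

level-doubling : ∀ {f} → Doubling f → ∀ l r → r ≤ f (suc l) → level f (f (suc l) + r) ≡ suc l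
level-doubling {f} double l r r≤fl =
  level-unique (doubling⇒increasing double) (f (suc l) + r) (suc l) (s≤s z≤n) (m≤m+n _ r)
    (subst (f (suc l) + r <_) (sym (double (suc l)))
      (≤-<-trans (+-monoʳ-≤ (f (suc l)) r≤fl) (m<m+n _ (s≤s z≤n))))

nth-++ˡ : ∀ xs ys i → i ≤ length xs → nth (xs ++ ys) i ≡ nth xs i
nth-++ˡ []       []       zero          _       = refl
nth-++ˡ []       (y ∷ ys) zero          _       = refl
nth-++ˡ (x ∷ xs) ys       zero          _       = refl
nth-++ˡ (x ∷ xs) ys       (suc zero)    _       = refl
nth-++ˡ (x ∷ xs) ys       (suc (suc i)) (s≤s i≤) = nth-++ˡ xs ys (suc i) i≤

nth-All : ∀ {P : ℕ → Set} {xs i} → All P xs → 1 ≤ i → i ≤ length xs → P (nth xs i)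
nth-All {i = suc zero}    (px ∷ _)   _ _        = px
nth-All {i = suc (suc i)} (_  ∷ pxs) _ (s≤s i≤) = nth-All pxs (s≤s z≤n) i≤

take-++-length : ∀ {A : Set} (xs ys : List A) r → take (length xs + r) (xs ++ ys) ≡ xs ++ take r ys
take-++-length []       ys r = refl
take-++-length (x ∷ xs) ys r = cong (x ∷_) (take-++-length xs ys r)

take-++ˡ : ∀ {A : Set} (xs ys : List A) r → r ≤ length xs → take r (xs ++ ys) ≡ take r xs
take-++ˡ xs       ys zero    _        = refl
take-++ˡ (x ∷ xs) ys (suc r) (s≤s r≤) = cong (x ∷_) (take-++ˡ xs ys r r≤)

sum-take-suc : ∀ xs n → suc n ≤ length xs → sum (take (suc n) xs) ≡ sum (take n xs) + nth xs (suc n)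
sum-take-suc (x ∷ xs) zero    _        = +-identityʳ x
sum-take-suc (x ∷ xs) (suc n) (s≤s n<) =
  trans (cong (x +_) (sum-take-suc xs n n<)) (sym (+-assoc x _ _))

Alist-measure : (g : List ℕ → ℕ) → (∀ xs ys → g (xs ++ ys) ≡ g xs + g ys) → g [ 1 ] ≡ 1 →
                ∀ {f} → Doubling f → g (Alist 0) ≡ f 1 → ∀ k → g (Alist k) ≡ f (suc k)
Alist-measure g g-++ g1 double base zero    = base
Alist-measure g g-++ g1 {f} double base (suc k) = begin
  g (X ++ X ++ [ 1 ])        ≡⟨ g-++ X _ ⟩
  g X + g (X ++ [ 1 ])       ≡⟨ cong (g X +_) (g-++ X [ 1 ]) ⟩
  g X + (g X + g [ 1 ])      ≡⟨ sym (+-assoc (g X) _ _) ⟩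
  g X + g X + g [ 1 ]        ≡⟨ cong₂ (λ m o → m + m + o) (Alist-measure g g-++ g1 {f} double base k)
                                      g1 ⟩
  f (suc k) + f (suc k) + 1  ≡⟨ sym (double (suc k)) ⟩
  f (suc (suc k))            ∎
  where
  open ≡-Reasoning
  X = Alist k

Alist-length : ∀ k → length (Alist k) ≡ M (suc k)
Alist-length = Alist-measure length (λ xs _ → length-++ xs) refl {M} M-doubling refl

Alist-sum : ∀ k → sum (Alist k) ≡ μ (suc k)
Alist-sum = Alist-measure sum sum-++ refl {μ} μ-doubling refl

Alist-positive : ∀ k → All (1 ≤_) (Alist k)
Alist-positive zero    = s≤s z≤n ∷ []
Alist-positive (suc k) = ++⁺ (Alist-positive k) (++⁺ (Alist-positive k) (s≤s z≤n ∷ []))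

Alist-prefix : ∀ j k → j ≤ k → ∃[ t ] Alist k ≡ Alist j ++ t
Alist-prefix j zero    z≤n = [] , refl
Alist-prefix j (suc k) j≤1+k with m≤n⇒m<n∨m≡n j≤1+k
... | inj₂ refl = [] , sym (++-identityʳ _)
... | inj₁ (s≤s j≤k) with Alist-prefix j k j≤k
...   | t , Ak≡Aj++t =
  t ++ Alist k ++ [ 1 ] , trans (cong (_++ Alist k ++ [ 1 ]) Ak≡Aj++t) (++-assoc (Alist j) t _)

Alist-long : ∀ k → suc k ≤ length (Alist k)
Alist-long k = subst (suc k ≤_) (sym (Alist-length k))
                 (increasing⇒id≤ M-increasing (suc k))

nth-Alist-stable : ∀ {j k} i → j ≤ k → i ≤ length (Alist j) → nth (Alist k) i ≡ nth (Alist j) i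
nth-Alist-stable {j} {k} i j≤k i≤ with Alist-prefix j k j≤k
... | t , Ak≡Aj++t = trans (cong (λ xs → nth xs i) Ak≡Aj++t) (nth-++ˡ (Alist j) t i i≤)

a≡nth-Alist : ∀ n k → suc n ≤ length (Alist k) → a (suc n) ≡ nth (Alist k) (suc n)
a≡nth-Alist n k n<len with ≤-total (suc n) k
... | inj₁ n<k = sym (nth-Alist-stable (suc n) n<k (≤-trans (n≤1+n _) (Alist-long (suc n))))
... | inj₂ k≤n = nth-Alist-stable (suc n) k≤n n<len

a-positive : ∀ n → 1 ≤ a (suc n)
a-positive n = nth-All (Alist-positive (suc n)) (s≤s z≤n) (≤-trans (n≤1+n _) (Alist-long (suc n)))

s-increasing : StrictlyIncreasing s
s-increasing i = m<m+n (s i) (a-positive i)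

s≡sum-take-Alist : ∀ n k → n ≤ length (Alist k) → s n ≡ sum (take n (Alist k))
s≡sum-take-Alist zero    k _     = refl
s≡sum-take-Alist (suc n) k n<len =
  trans (cong₂ _+_ (s≡sum-take-Alist n k (≤-trans (n≤1+n n) n<len)) (a≡nth-Alist n k n<len))
        (sym (sum-take-suc (Alist k) n n<len))

s-split : ∀ l r → r ≤ M (suc l) → s (M (suc l) + r) ≡ μ (suc l) + s r
s-split l r r≤ = begin
  s (M (suc l) + r)
    ≡⟨ s≡sum-take-Alist _ (suc l) in-range ⟩
  sum (take (M (suc l) + r) (X ++ X ++ [ 1 ]))
    ≡⟨ cong (λ m → sum (take (m + r) (X ++ X ++ [ 1 ]))) (sym (Alist-length l)) ⟩
  sum (take (length X + r) (X ++ X ++ [ 1 ]))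
    ≡⟨ cong sum (take-++-length X _ r) ⟩
  sum (X ++ take r (X ++ [ 1 ]))
    ≡⟨ sum-++ X _ ⟩
  sum X + sum (take r (X ++ [ 1 ]))
    ≡⟨ cong₂ _+_ (Alist-sum l) (cong sum (take-++ˡ X [ 1 ] r r≤len)) ⟩
  μ (suc l) + sum (take r X)
    ≡⟨ cong (μ (suc l) +_) (sym (s≡sum-take-Alist r l r≤len)) ⟩
  μ (suc l) + s r
    ∎
  where
  open ≡-Reasoning
  X = Alist l
  r≤len : r ≤ length X
  r≤len = subst (r ≤_) (sym (Alist-length l)) r≤
  in-range : M (suc l) + r ≤ length (Alist (suc l))
  in-range = subst (M (suc l) + r ≤_) (trans (sym (M-doubling (suc l))) (sym (Alist-length (suc l))))
               (≤-trans (+-monoʳ-≤ (M (suc l)) r≤) (m≤m+n _ 1))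

s-M : ∀ l → s (M (suc l)) ≡ μ (suc l)
s-M l = trans (cong s (sym (+-identityʳ (M (suc l))))) (trans (s-split l 0 z≤n) (+-identityʳ _))

M-positive : ∀ l → 1 ≤ M (suc l)
M-positive l = ≤-trans (s≤s z≤n) (increasing⇒id≤ M-increasing (suc l))

M-decomposition : ∀ m → ∃[ l ] ∃[ r ] r ≤ M (suc l) × M (suc l) + r ≡ suc m
M-decomposition zero = 0 , 0 , z≤n , refl
M-decomposition (suc m) with M-decomposition m
... | l , r , r≤ , eq with m≤n⇒m<n∨m≡n r≤
...   | inj₁ r< = l , suc r , r< , trans (+-suc _ r) (cong suc eq)
...   | inj₂ refl = suc l , 0 , z≤n ,
  trans (+-identityʳ _) (trans (M-doubling (suc l)) (trans (+-comm _ 1) (cong suc eq)))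

Mstep : ℕ → Bool → Bool → List ℕ → List ℕ
Mstep ℓ last double rest = if last then ℓ ∷ [] else if double then ℓ ∷ ℓ ∷ [] else ℓ ∷ rest

μstep : ℕ → Bool → Bool → List ℕ × ℕ → List ℕ × ℕ
μstep ℓ last double (rest , remainder) =
  if last then (ℓ ∷ [] , 0) else if double then (ℓ ∷ ℓ ∷ [] , 0) else (ℓ ∷ rest , remainder)

μstep-remainder-0 : ∀ ℓ last double rest →
                    μstep ℓ last double (rest , 0) ≡ (Mstep ℓ last double rest , 0)
μstep-remainder-0 ℓ true  _     rest = refl
μstep-remainder-0 ℓ false true  rest = refl
μstep-remainder-0 ℓ false false rest = refl

Msteps-zero : ∀ fuel → Msteps fuel 0 ≡ []
Msteps-zero zero    = refl
Msteps-zero (suc _) = refl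

μsteps-zero : ∀ fuel → μsteps fuel 0 ≡ ([] , 0)
μsteps-zero zero    = refl
μsteps-zero (suc _) = refl

Msteps-unfold : ∀ fuel {n} → 1 ≤ n → ∀ {ℓ r} → level M n ≡ ℓ → n ∸ M ℓ ≡ r →
                Msteps (suc fuel) n ≡ Mstep ℓ (r ≡ᵇ 0) (r ≡ᵇ M ℓ) (Msteps fuel r)
Msteps-unfold fuel (s≤s z≤n) refl refl = refl

μsteps-unfold : ∀ fuel {n} → 5 ≤ n → ∀ {ℓ r} → level μ n ≡ ℓ → n ∸ μ ℓ ≡ r →
                μsteps (suc fuel) n ≡ μstep ℓ (r ≡ᵇ 0) (r ≡ᵇ μ ℓ) (μsteps fuel r)
μsteps-unfold fuel {n} 4<n refl refl rewrite det (≤ᵇ-reflects-≤ n 4) (ofⁿ (<⇒≱ 4<n)) = refl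

expansions-agree-step : ∀ fuel fuel' l r → r ≤ M (suc l) →
                        μsteps fuel' (s r) ≡ (Msteps fuel r , 0) →
                        μsteps (suc fuel') (s (M (suc l) + r))
                          ≡ (Msteps (suc fuel) (M (suc l) + r) , 0)
expansions-agree-step fuel fuel' l r r≤ agree-r = begin
  μsteps (suc fuel') (s (M L + r))
    ≡⟨ cong (μsteps (suc fuel')) (s-split l r r≤) ⟩
  μsteps (suc fuel') (μ L + s r)
    ≡⟨ μsteps-unfold fuel' μ-large (level-doubling {μ} μ-doubling l (s r) sr≤)
                                   (m+n∸m≡n (μ L) (s r)) ⟩
  μstep L (s r ≡ᵇ 0) (s r ≡ᵇ μ L) (μsteps fuel' (s r))
    ≡⟨ cong₂ (λ last double → μstep L last double (μsteps fuel' (s r))) same-last same-double ⟩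
  μstep L (r ≡ᵇ 0) (r ≡ᵇ M L) (μsteps fuel' (s r))
    ≡⟨ cong (μstep L (r ≡ᵇ 0) (r ≡ᵇ M L)) agree-r ⟩
  μstep L (r ≡ᵇ 0) (r ≡ᵇ M L) (Msteps fuel r , 0)
    ≡⟨ μstep-remainder-0 L (r ≡ᵇ 0) (r ≡ᵇ M L) (Msteps fuel r) ⟩
  (Mstep L (r ≡ᵇ 0) (r ≡ᵇ M L) (Msteps fuel r) , 0)
    ≡⟨ cong (_, 0) (sym (Msteps-unfold fuel M-large (level-doubling {M} M-doubling l r r≤)
                                                     (m+n∸m≡n (M L) r))) ⟩
  (Msteps (suc fuel) (M L + r) , 0)
    ∎
  where
  open ≡-Reasoning
  L = suc l
  s-injective : Injective _≡_ _≡_ s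
  s-injective = increasing⇒injective s-increasing
  sr≤ : s r ≤ μ L
  sr≤ = subst (s r ≤_) (s-M l) (increasing⇒monotone s-increasing r≤)
  μ-large : 5 ≤ μ L + s r
  μ-large = ≤-trans (increasing⇒monotone μ-increasing {1} {L} (s≤s z≤n)) (m≤m+n (μ L) (s r))
  M-large : 1 ≤ M L + r
  M-large = ≤-trans (M-positive l) (m≤m+n _ r)
  same-last : (s r ≡ᵇ 0) ≡ (r ≡ᵇ 0)
  same-last = ≡ᵇ-injective s-injective r 0
  same-double : (s r ≡ᵇ μ L) ≡ (r ≡ᵇ M L)
  same-double = trans (cong (s r ≡ᵇ_) (sym (s-M l))) (≡ᵇ-injective s-injective r (M L))

expansions-agree : ∀ fuel fuel' n → n ≤ fuel → s n ≤ fuel' →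
                   μsteps fuel' (s n) ≡ (Msteps fuel n , 0)
expansions-agree fuel fuel' zero _ _ =
  trans (μsteps-zero fuel') (cong (_, 0) (sym (Msteps-zero fuel)))
expansions-agree zero fuel' (suc m) () _
expansions-agree (suc fuel) zero (suc m) _ sn≤0 =
  contradiction sn≤0 (<⇒≱ (increasing⇒strictMono s-increasing {0} {suc m} (s≤s z≤n)))
expansions-agree (suc fuel) (suc fuel') (suc m) n≤ sn≤ with M-decomposition m
... | l , r , r≤ , eq =
  subst (λ n → μsteps (suc fuel') (s n) ≡ (Msteps (suc fuel) n , 0)) eq
    (expansions-agree-step fuel fuel' l r r≤
      (expansions-agree fuel fuel' r (≤-pred (≤-trans r<n n≤))
                                     (≤-pred (≤-trans (increasing⇒strictMono s-increasing r<n) sn≤))))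
  where
  r<n : r < suc m
  r<n = subst (r <_) eq (m<n+m r (M-positive l))

lemma2p1 : (n : ℕ) → 1 ≤ n → (μremainder (s n) ≡ 0) × (μdigits (s n) ≡ Mdigits n)
lemma2p1 n _ = cong proj₂ agree , cong (digits ∘ proj₁) agree
  where
  agree : μsteps (s n) (s n) ≡ (Msteps n n , 0)
  agree = expansions-agree n (s n) n ≤-refl ≤-refl
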